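{- Let $W = T[\ell_i..r_i]$ be a non-empty string, let $\mathit{lrp}$ and $\mathit{lrs}$ be the longest repeating prefix and longest repeating suffix of $W$, and consider the suffix tree of $W$. Then the locus of $\mathit{lrp}$ lies on (the interior of) the edge leading to $\mathrm{leaf}(\ell_i)$ if and only if the locus of $\mathit{lrs}$ lies on (the interior of) the edge leading to $\mathrm{leaf}(\ell_i)$.
   Context: The suffix tree of a string $W$ is the compacted trie of all suffixes of $W$ (no terminal symbol appended); every non-root internal node is branching. Every substring of $W$ has a locus, which is either a node or a position strictly inside an edge. $\mathrm{leaf}(\ell_i)$ is the leaf representing the whole string $W = T[\ell_i..r_i]$. The longest repeating prefix (resp. suffix) of a string is its longest prefix (resp. suffix) occurring at least twice in it (occurrences may overlap); it may be empty. -}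

module Defs where

open import Data.List using (List; []; _∷_; _++_; [_]; length)
open import Data.Nat using (ℕ; _≤_; _<_)
open import Data.Product using (Σ; ∃; ∃-syntax; _×_)
open import Data.Sum using (_⊎_)
open import Relation.Binary.PropositionalEquality using (_≡_; _≢_)
open import Relation.Nullary using (¬_)

module _ {A : Set} where

  IsPrefix : List A → List A → Set
  IsPrefix u W = ∃[ y ] W ≡ u ++ y

  IsSuffix : List A → List A → Set
  IsSuffix u W = ∃[ x ] W ≡ x ++ u

  Substring : List A → List A → Set
  Substring u W = ∃[ x ] ∃[ y ] W ≡ x ++ u ++ y

  OccursTwice : List A → List A → Set
  OccursTwice u W =
    ∃[ x₁ ] ∃[ y₁ ] ∃[ x₂ ] ∃[ y₂ ]
      (W ≡ x₁ ++ u ++ y₁) × (W ≡ x₂ ++ u ++ y₂) × (length x₁ ≢ length x₂)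

  IsLRP : List A → List A → Set
  IsLRP W p = IsPrefix p W × OccursTwice p W
            × (∀ q → IsPrefix q W → OccursTwice q W → length q ≤ length p)

  IsLRS : List A → List A → Set
  IsLRS W s = IsSuffix s W × OccursTwice s W
            × (∀ q → IsSuffix q W → OccursTwice q W → length q ≤ length s)

  -- Suffix tree of W (compacted trie of all suffixes, no terminal symbol).
  -- Every substring is identified with its locus. The explicit nodes are:
  -- the root (empty string), branching (right-branching) substrings, and
  -- leaves (substrings with no right extension in W).
  Branching : List A → List A → Set
  Branching u W = ∃[ a ] ∃[ b ] (a ≢ b) × Substring (u ++ [ a ]) W × Substring (u ++ [ b ]) W

  IsLeaf : List A → List A → Set
  IsLeaf u W = Substring u W × (∀ a → ¬ Substring (u ++ [ a ]) W)

  IsNode : List A → List A → Set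
  IsNode u W = (u ≡ []) ⊎ Branching u W ⊎ IsLeaf u W

  -- leaf(ℓ_i) is the leaf for W itself. The locus of u lies strictly inside
  -- the edge leading to this leaf iff u is on the root-to-leaf(W) path
  -- (a prefix of W), above the leaf, and no node lies on that path at
  -- string depth in [|u|, |W|) (i.e. u is deeper than the leaf's parent
  -- and is itself not a node).
  OnLeafEdgeInterior : List A → List A → Set
  OnLeafEdgeInterior W u =
    IsPrefix u W × length u < length W
    × (∀ v → IsPrefix v W → length u ≤ length v → length v < length W → ¬ IsNode v W)

-- If the locus of lrp is inside the edge to leaf(W), then lrp is not a node,
-- so it is not branching; since every extension lrp c occurs only once, any
-- later occurrence of lrp ends W, i.e. lrp is a suffix of W. Then lrp is a
-- repeating suffix no longer than lrs, hence a suffix of lrs; a non-final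
-- occurrence of lrs carries a non-final occurrence of lrp, which must be the
-- initial one, forcing lrs = lrp. Conversely, if lrs is on that edge it is a
-- repeating prefix, so |lrs| ≤ |lrp| and lrp lies on the same edge, deeper.
module Submission where

open import Defs
open import Data.List using (List; []; _∷_; _++_; _∷ʳ_; length)
open import Data.List.Properties
  using (length-++; length-++-≤ˡ; length-++-≤ʳ; ++-assoc; ++-identityʳ; ++-cancelʳ; ++-conicalʳ; ∷-injective; ∷ʳ-++)
open import Data.Nat using (_≤_; _<_; s≤s)
open import Data.Nat.Properties using (≤-refl; ≤-trans; m+1+n≰m; <-irrefl)
open import Data.Product using (∃-syntax; _,_; proj₁; proj₂)
open import Data.Sum using (inj₁; inj₂)
open import Data.Empty using (⊥-elim)
open import Relation.Nullary using (¬_)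
open import Relation.Binary.PropositionalEquality
  using (_≡_; _≢_; refl; sym; trans; cong; subst; module ≡-Reasoning)
open import Function.Bundles using (_⇔_; mk⇔)

module _ {A : Set} where

  ++-suffix-of-longer : ∀ (x y : List A) {u v} → x ++ u ≡ y ++ v → length u ≤ length v → IsSuffix u v
  ++-suffix-of-longer x       []      eq  _   = x , sym eq
  ++-suffix-of-longer []      (_ ∷ y) refl u≤v = ⊥-elim (<-irrefl refl (≤-trans (s≤s (length-++-≤ʳ _ {y})) u≤v))
  ++-suffix-of-longer (_ ∷ x) (_ ∷ y) eq  u≤v with ∷-injective eq
  ... | refl , eq′ = ++-suffix-of-longer x y eq′ u≤v

  proper-prefix⇒followed : ∀ {p W : List A} → IsPrefix p W → length p < length W → ∃[ c ] ∃[ y ] W ≡ p ++ c ∷ y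
  proper-prefix⇒followed (c ∷ y , eq) _ = c , y , eq
  proper-prefix⇒followed {p} ([] , eq) p<W =
    ⊥-elim (<-irrefl (sym (cong length (trans eq (++-identityʳ p)))) p<W)

  occursTwice⇒non-initial : ∀ {u W : List A} → OccursTwice u W → ∃[ a ] ∃[ x ] ∃[ y ] W ≡ (a ∷ x) ++ u ++ y
  occursTwice⇒non-initial (a ∷ x , y , _ , _ , eq , _ , _)      = a , x , y , eq
  occursTwice⇒non-initial ([] , _ , a ∷ x , y , _ , eq , _)     = a , x , y , eq
  occursTwice⇒non-initial ([] , _ , [] , _ , _ , _ , x₁≢x₂)     = ⊥-elim (x₁≢x₂ refl)

  occursTwice⇒non-final : ∀ {u W : List A} → OccursTwice u W → ∃[ x ] ∃[ d ] ∃[ z ] W ≡ x ++ u ++ d ∷ z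
  occursTwice⇒non-final (x , d ∷ z , _ , _ , eq , _ , _)       = x , d , z , eq
  occursTwice⇒non-final (_ , [] , x , d ∷ z , _ , eq , _)      = x , d , z , eq
  occursTwice⇒non-final {u} (x₁ , [] , x₂ , [] , eq₁ , eq₂ , x₁≢x₂) =
    ⊥-elim (x₁≢x₂ (cong length (++-cancelʳ (u ++ []) x₁ x₂ (trans (sym eq₁) eq₂))))

  occursTwice⇒shorter : ∀ {u W : List A} → OccursTwice u W → length u < length W
  occursTwice⇒shorter {u} occ with occursTwice⇒non-initial occ
  ... | _ , x , y , refl = s≤s (≤-trans (length-++-≤ˡ u) (length-++-≤ʳ (u ++ y) {x}))

  -- Were p followed by d somewhere else, either d differs from the letter c
  -- after the initial occurrence (p branches) or p c repeats (p is not longest).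
  nonBranching-lrp⇒non-final-occurrence-initial :
    ∀ {W p : List A} → IsLRP W p → ¬ Branching p W → length p < length W →
    ∀ w d z → W ≡ w ++ p ++ d ∷ z → w ≡ []
  nonBranching-lrp⇒non-final-occurrence-initial _ _ _ [] _ _ _ = refl
  nonBranching-lrp⇒non-final-occurrence-initial {W} {p} (pref , _ , longest) nb p<W (a ∷ x) d z eq
    with proper-prefix⇒followed pref p<W
  ... | c , y , eqW = ⊥-elim (nb (d , c , d≢c , (a ∷ x , z , eq′) , ([] , y , eqW′)))
    where
    eq′ : W ≡ (a ∷ x) ++ (p ∷ʳ d) ++ z
    eq′ = trans eq (cong ((a ∷ x) ++_) (sym (∷ʳ-++ p d z)))
    eqW′ : W ≡ (p ∷ʳ c) ++ y
    eqW′ = trans eqW (sym (∷ʳ-++ p c y))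
    d≢c : d ≢ c
    d≢c refl = m+1+n≰m (length p) {0} (subst (_≤ length p) (length-++ p)
      (longest (p ∷ʳ d) (y , eqW′) ([] , y , a ∷ x , z , eqW′ , eq′ , λ ())))

  onLeafEdge⇒nonBranching : ∀ {W u : List A} → OnLeafEdgeInterior W u → ¬ Branching u W
  onLeafEdge⇒nonBranching {u = u} (pref , u<W , noNode) br = noNode u pref ≤-refl u<W (inj₂ (inj₁ br))

  nonBranching-lrp⇒suffix : ∀ {W p : List A} → IsLRP W p → ¬ Branching p W → length p < length W → IsSuffix p W
  nonBranching-lrp⇒suffix {p = p} isLRP@(_ , occ , _) nb p<W with occursTwice⇒non-initial occ
  ... | a , x , [] , eq    = a ∷ x , trans eq (cong ((a ∷ x) ++_) (++-identityʳ p))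
  ... | a , x , d ∷ z , eq with nonBranching-lrp⇒non-final-occurrence-initial isLRP nb p<W (a ∷ x) d z eq
  ... | ()

  onLeafEdge-lrp⇒lrs≡lrp : ∀ {W lrp lrs : List A} → IsLRP W lrp → IsLRS W lrs → OnLeafEdgeInterior W lrp → lrs ≡ lrp
  onLeafEdge-lrp⇒lrs≡lrp {W} {lrp} {lrs} isLRP@(_ , occP , _) (sufS , occS , longestS) onEdge@(_ , lrp<W , _)
    with occursTwice⇒non-final occS
  ... | x , d , z , eq = trans lrs≡m++lrp (cong (_++ lrp) (++-conicalʳ x m x++m≡[]))
    where
    open ≡-Reasoning
    nb : ¬ Branching lrp W
    nb = onLeafEdge⇒nonBranching onEdge
    sufP : IsSuffix lrp W
    sufP = nonBranching-lrp⇒suffix isLRP nb lrp<W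
    lrp-suffix-of-lrs : IsSuffix lrp lrs
    lrp-suffix-of-lrs = ++-suffix-of-longer (proj₁ sufP) (proj₁ sufS)
      (trans (sym (proj₂ sufP)) (proj₂ sufS)) (longestS lrp sufP occP)
    m : List A
    m = proj₁ lrp-suffix-of-lrs
    lrs≡m++lrp : lrs ≡ m ++ lrp
    lrs≡m++lrp = proj₂ lrp-suffix-of-lrs
    x++m≡[] : x ++ m ≡ []
    x++m≡[] = nonBranching-lrp⇒non-final-occurrence-initial isLRP nb lrp<W (x ++ m) d z (begin
      W                        ≡⟨ eq ⟩
      x ++ lrs ++ d ∷ z        ≡⟨ cong (λ s → x ++ s ++ d ∷ z) lrs≡m++lrp ⟩
      x ++ (m ++ lrp) ++ d ∷ z ≡⟨ cong (x ++_) (++-assoc m lrp (d ∷ z)) ⟩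
      x ++ m ++ lrp ++ d ∷ z   ≡⟨ sym (++-assoc x m (lrp ++ d ∷ z)) ⟩
      (x ++ m) ++ lrp ++ d ∷ z ∎)

  onLeafEdge-lrs⇒onLeafEdge-lrp : ∀ {W lrp lrs : List A} → IsLRP W lrp → IsLRS W lrs →
                                  OnLeafEdgeInterior W lrs → OnLeafEdgeInterior W lrp
  onLeafEdge-lrs⇒onLeafEdge-lrp (prefP , occP , longestP) (_ , occS , _) (prefL , _ , noNode) =
    prefP , occursTwice⇒shorter occP ,
    λ v pv lrp≤v v<W → noNode v pv (≤-trans (longestP _ prefL occS) lrp≤v) v<W

lemma4 : {A : Set} (W lrp lrs : List A) → W ≢ [] → IsLRP W lrp → IsLRS W lrs
           → (OnLeafEdgeInterior W lrp ⇔ OnLeafEdgeInterior W lrs)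
lemma4 W lrp lrs _ isLRP isLRS = mk⇔
  (λ onEdge → subst (OnLeafEdgeInterior W) (sym (onLeafEdge-lrp⇒lrs≡lrp isLRP isLRS onEdge)) onEdge)
  (onLeafEdge-lrs⇒onLeafEdge-lrp isLRP isLRS)
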